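{- Let $r\geq 3$, let $\ell\geq 1$, let $Q'\in\mathcal{C}_{\ell-1}$, and let $(x_1,x_2,y_1,y_2)$ specify a reverse $\ell$-switching in $Q'$, with $x_j\in\widehat W_j$ ($j=1,2$) and $y_1,y_2\in\widehat U$, producing the partition $Q$. Let $\widehat e,\widehat f_1,\widehat f_2$ be the edges of $G(Q')$ corresponding to $\widehat U,\widehat W_1,\widehat W_2$. If this reverse $\ell$-switching is illegal for $Q'$, then at least one of the following holds: (I$'$) at least one of $\widehat U,\widehat W_1,\widehat W_2$ contains a loop; (II$'$) $\widehat e\cap\widehat f_j\neq\emptyset$ for some $j\in\{1,2\}$; (III$'$) some edge of $G(Q')$ other than $\widehat e,\widehat f_1,\widehat f_2$ intersects both $\widehat e$ and $\widehat f_j$ for some $j\in\{1,2\}$.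
   Context: Let $\mathbf{k}=(k_1,\ldots,k_n)$ be nonnegative integers with $M=\sum_ik_i$ divisible by $r$, $M_2=\sum_ik_i(k_i-1)$. Let $B_1,\ldots,B_n$ be disjoint sets ("cells") with $|B_i|=k_i$ and $\mathcal{B}=\bigcup_iB_i$ ("points"). $\Lambda_r(\mathbf{k})$ is the set of unordered partitions of $\mathcal{B}$ into $M/r$ parts of size $r$. For $Q\in\Lambda_r(\mathbf{k})$, $G(Q)$ is the hypergraph on $\{1,\ldots,n\}$ with one edge $e_U$ per part $U$, vertex $i$ having multiplicity $|U\cap B_i|$ in $e_U$. A loop in a part $U$ is a pair of distinct points of $U$ in the same cell. Edge intersections are multiset intersections with size counted with multiplicity; two edges "intersect" if they share a vertex. Let $N=\max\{\lceil\log M\rceil,\lceil 9(r-1)M_2/M\rceil\}$. $\Lambda_r^+(\mathbf{k})$ is the set of $Q\in\Lambda_r(\mathbf{k})$ with: (i) $|U\cap B_i|\le 2$ for all parts $U$ and all $i$; (ii) each part $U$ has at most one $i$ with $|U\cap B_i|=2$; (iii) for distinct parts $U_1,U_2$, $|e_{U_1}\cap e_{U_2}|\le 2$; (iv) at most $N$ parts contain a loop. $\mathcal{C}_\ell$ is the set of $Q\in\Lambda_r^+(\mathbf{k})$ with exactly $\ell$ parts containing a loop. A reverse $\ell$-switching in a partition $Q'$ is specified by a 4-tuple of points $(x_1,x_2,y_1,y_2)$ where $x_j$ lies in the part $\widehat W_j$ of $Q'$ ($j=1,2$), $y_1,y_2$ are distinct points of a part $\widehat U$ of $Q'$, the parts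 $\widehat U,\widehat W_1,\widehat W_2$ are distinct, $x_1,x_2$ lie in the same cell, and $y_1,y_2$ lie in distinct cells; it produces $Q=(Q'\setminus\{\widehat U,\widehat W_1,\widehat W_2\})\cup\{U,W_1,W_2\}$ where $U=(\widehat U\setminus\{y_1,y_2\})\cup\{x_1,x_2\}$, $W_1=(\widehat W_1\setminus\{x_1\})\cup\{y_1\}$, $W_2=(\widehat W_2\setminus\{x_2\})\cup\{y_2\}$. It is legal for $Q'\in\mathcal{C}_{\ell-1}$ if $Q\in\mathcal{C}_\ell$, and illegal otherwise. -}

module Defs where

open import Data.Nat using (ℕ; zero; suc; _+_; _≤_; _⊓_)
open import Data.Fin using (Fin; zero; suc)
open import Data.Fin.Properties using (_≟_)
open import Data.Bool using (Bool; true; false; _∧_; _∨_; if_then_else_)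
open import Data.Product using (Σ; _×_; ∃)
open import Data.Sum using (_⊎_)
open import Relation.Nullary using (¬_)
open import Relation.Nullary.Decidable using (⌊_⌋)
open import Relation.Binary.PropositionalEquality using (_≡_; _≢_)

-- Points are Fin M; a cell assignment  cell : Fin M → Fin n  (B_i = fibre of i,
-- k_i = |B_i|).  A partition of the points into parts is represented by a
-- labelling  part : Fin M → Fin p  of points by part labels (the unordered
-- partition is the set of non-empty fibres; all notions below are invariant
-- under relabelling).

count : {m : ℕ} → (Fin m → Bool) → ℕ
count {zero}  f = 0
count {suc m} f = (if f zero then 1 else 0) + count {m} (λ i → f (suc i))

sumFin : {m : ℕ} → (Fin m → ℕ) → ℕ
sumFin {zero}  f = 0
sumFin {suc m} f = f zero + sumFin {m} (λ i → f (suc i))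

module _ {M n p : ℕ} (cell : Fin M → Fin n) (part : Fin M → Fin p) where

  -- |U ∩ B_i| : multiplicity of vertex i in the edge e_U
  mult : Fin p → Fin n → ℕ
  mult u i = count (λ x → ⌊ part x ≟ u ⌋ ∧ ⌊ cell x ≟ i ⌋)

  size : Fin p → ℕ
  size u = count (λ x → ⌊ part x ≟ u ⌋)

  IsPartition : ℕ → Set
  IsPartition r = ∀ u → size u ≡ r

  HasLoop : Fin p → Set
  HasLoop u = Σ (Fin M) λ x → Σ (Fin M) λ y →
    x ≢ y × part x ≡ u × part y ≡ u × cell x ≡ cell y

  LoopParts : ℕ → Set
  LoopParts ℓ = Σ (Fin p → Bool) λ sel →
    (∀ u → (sel u ≡ true → HasLoop u) × (HasLoop u → sel u ≡ true))
    × count sel ≡ ℓ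

  interSize : Fin p → Fin p → ℕ
  interSize u w = sumFin (λ i → mult u i ⊓ mult w i)

  Intersect : Fin p → Fin p → Set
  Intersect u w = ∃ λ i → 1 ≤ mult u i × 1 ≤ mult w i

  InC : ℕ → ℕ → ℕ → Set
  InC r N ℓ =
    IsPartition r
    × (∀ u i → mult u i ≤ 2)
    × (∀ u i j → mult u i ≡ 2 → mult u j ≡ 2 → i ≡ j)
    × (∀ u w → u ≢ w → interSize u w ≤ 2)
    × LoopParts ℓ × ℓ ≤ N

IsReverseSwitching : {M n p : ℕ} → (Fin M → Fin n) → (Fin M → Fin p) →
  Fin M → Fin M → Fin M → Fin M → Set
IsReverseSwitching cell part x₁ x₂ y₁ y₂ =
  y₁ ≢ y₂ × part y₁ ≡ part y₂
  × part y₁ ≢ part x₁ × part y₁ ≢ part x₂ × part x₁ ≢ part x₂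
  × cell x₁ ≡ cell x₂ × cell y₁ ≢ cell y₂

-- the partition Q produced: U = (Û∖{y₁,y₂})∪{x₁,x₂}, W_j = (Ŵ_j∖{x_j})∪{y_j}
-- (the new parts keep the labels of Û, Ŵ₁, Ŵ₂ respectively)
switch : {M p : ℕ} → (Fin M → Fin p) → Fin M → Fin M → Fin M → Fin M →
  Fin M → Fin p
switch part x₁ x₂ y₁ y₂ z =
  if ⌊ z ≟ x₁ ⌋ ∨ ⌊ z ≟ x₂ ⌋ then part y₁
  else if ⌊ z ≟ y₁ ⌋ then part x₁
  else if ⌊ z ≟ y₂ ⌋ then part x₂
  else part z

-- Suppose none of (I′)–(III′) holds; we show that the switching is legal. Only x₁, x₂, y₁, y₂ change
-- parts, so only the edges of U, W₁, W₂ change: U trades the vertices b₁, b₂ (the cells of y₁, y₂) for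
-- the double vertex a (the cell of x₁, x₂), and Wⱼ trades a for bⱼ. As Û, Ŵ₁, Ŵ₂ are loop-free and ê
-- meets neither f̂ⱼ, U gets exactly one loop (at a), the Wⱼ stay loop-free, U is disjoint from both Wⱼ,
-- and W₁ ∩ W₂ ⊆ Ŵ₁ ∩ Ŵ₂. An unchanged edge can meet U (resp. Wⱼ) more than it met Û (resp. Ŵⱼ) only
-- if it contains a (resp. bⱼ); then it meets Ŵ₁ (resp. Û), so by ¬(III′) it meets U (resp. Wⱼ) only
-- at that vertex, where the multiplicity is 2 (resp. 1). Hence Q satisfies (i)–(iii) and has exactly
-- one more part with a loop than Q′.

module Submission where

open import Defs
open import Data.Nat using (ℕ; zero; suc; _+_; _≤_; _∸_; _⊓_; z≤n; s≤s; _≤?_)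
open import Data.Nat.Properties
  using (≤-trans; ≤-reflexive; ≤-pred; ≰⇒>; n≤0⇒n≡0; n<1⇒n≡0; m≤n+m; +-mono-≤; +-identityʳ;
         m⊓n≤m; ⊓-zeroʳ; ⊓-comm; ⊓-mono-≤; +-commutativeSemigroup)
open import Data.Fin using (Fin; zero; suc)
open import Data.Fin.Properties using (_≟_; any?; suc-injective)
open import Data.Bool using (Bool; true; false; _∧_; _∨_; not; if_then_else_; T)
open import Data.Bool.Properties using (∨-identityʳ; ∨-zeroʳ)
open import Data.List using (List; []; _∷_; foldr)
open import Data.List.Relation.Unary.All as All using (All; []; _∷_)
open import Data.List.Relation.Unary.AllPairs using ([]; _∷_)
open import Data.List.Relation.Unary.Unique.Propositional using (Unique)
open import Data.Product using (Σ; _×_; _,_; ∃; ∃₂; proj₁; proj₂)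
open import Data.Sum using (_⊎_; inj₁; inj₂)
open import Data.Empty using (⊥-elim)
open import Function using (_∘_)
open import Relation.Nullary using (¬_; Dec; yes; no; contradiction)
open import Relation.Nullary.Decidable
  using (⌊_⌋; ⌊⌋-map′; isYes≗does; dec-true; dec-false; toWitness; _×-dec_; _⊎-dec_; ¬?)
open import Relation.Binary.PropositionalEquality
open ≡-Reasoning
open import Data.Nat.Tactic.RingSolver using (solve-∀)
open import Algebra.Properties.CommutativeSemigroup +-commutativeSemigroup using (x∙yz≈y∙xz)

𝟙 : Bool → ℕ
𝟙 b = if b then 1 else 0

private
  variable
    m : ℕ
    s t : Fin m
    f g : Fin m → Bool

≡⇒≟-true : s ≡ t → ⌊ s ≟ t ⌋ ≡ true
≡⇒≟-true {s = s} {t} s≡t = trans (isYes≗does (s ≟ t)) (dec-true (s ≟ t) s≡t)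

≟-refl : (s : Fin m) → ⌊ s ≟ s ⌋ ≡ true
≟-refl s = ≡⇒≟-true refl

≢⇒≟-false : s ≢ t → ⌊ s ≟ t ⌋ ≡ false
≢⇒≟-false {s = s} {t} s≢t = trans (isYes≗does (s ≟ t)) (dec-false (s ≟ t) s≢t)

≟-true⇒≡ : ⌊ s ≟ t ⌋ ≡ true → s ≡ t
≟-true⇒≡ e = toWitness (subst T (sym e) _)

not-≟-true⇒≢ : not ⌊ s ≟ t ⌋ ≡ true → s ≢ t
not-≟-true⇒≢ {s = s} e refl with () ← trans (sym (cong not (≟-refl s))) e

∧-true⇒ : ∀ {x y} → x ∧ y ≡ true → x ≡ true × y ≡ true
∧-true⇒ {true} e = refl , e

count-cong : (∀ z → f z ≡ g z) → count f ≡ count g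
count-cong {zero}  f≗g = refl
count-cong {suc m} f≗g = cong₂ _+_ (cong 𝟙 (f≗g zero)) (count-cong (f≗g ∘ suc))

count-mono : (∀ z → f z ≡ true → g z ≡ true) → count f ≤ count g
count-mono {zero} f⇒g = z≤n
count-mono {suc m} {f} {g} f⇒g with f zero in f0 | g zero in g0
... | true  | true  = s≤s (count-mono (f⇒g ∘ suc))
... | true  | false with () ← trans (sym g0) (f⇒g zero f0)
... | false | true  = ≤-trans (count-mono (f⇒g ∘ suc)) (m≤n+m _ 1)
... | false | false = count-mono (f⇒g ∘ suc)

count-remove : (f : Fin m → Bool) (a : Fin m) →
  count f ≡ 𝟙 (f a) + count (λ z → not ⌊ z ≟ a ⌋ ∧ f z)
count-remove {suc m} f zero    = refl
count-remove {suc m} f (suc a) = begin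
  𝟙 (f zero) + count (f ∘ suc)
    ≡⟨ cong (𝟙 (f zero) +_) (count-remove (f ∘ suc) a) ⟩
  𝟙 (f zero) + (𝟙 (f (suc a)) + count (λ z → not ⌊ z ≟ a ⌋ ∧ f (suc z)))
    ≡⟨ x∙yz≈y∙xz (𝟙 (f zero)) (𝟙 (f (suc a))) _ ⟩
  𝟙 (f (suc a)) + (𝟙 (f zero) + count (λ z → not ⌊ z ≟ a ⌋ ∧ f (suc z)))
    ≡⟨ cong (λ c → 𝟙 (f (suc a)) + (𝟙 (f zero) + c))
         (count-cong λ z → cong (λ b → not b ∧ f (suc z)) (sym (⌊⌋-map′ _ _ (z ≟ a)))) ⟩
  𝟙 (f (suc a)) + (𝟙 (f zero) + count (λ z → not ⌊ suc z ≟ suc a ⌋ ∧ f (suc z))) ∎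

count-remove-true : (a : Fin m) → f a ≡ true →
  count f ≡ suc (count (λ z → not ⌊ z ≟ a ⌋ ∧ f z))
count-remove-true {f = f} a fa rewrite count-remove f a | fa = refl

count⇒witness : 1 ≤ count f → ∃ λ z → f z ≡ true
count⇒witness {suc m} {f} 1≤c with f zero in f0
... | true  = zero , f0
... | false with count⇒witness {f = f ∘ suc} 1≤c
... | z , fz = suc z , fz

witness⇒count : ∀ z → f z ≡ true → 1 ≤ count f
witness⇒count {f = f} z fz rewrite count-remove-true {f = f} z fz = s≤s z≤n

count⇒two-witnesses : 2 ≤ count f → ∃₂ λ x y → x ≢ y × f x ≡ true × f y ≡ true
count⇒two-witnesses {f = f} 2≤c with count⇒witness (≤-trans (s≤s z≤n) 2≤c)
... | x , fx with count⇒witness {f = λ z → not ⌊ z ≟ x ⌋ ∧ f z} rest-pos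
  where
  rest-pos : 1 ≤ count (λ z → not ⌊ z ≟ x ⌋ ∧ f z)
  rest-pos = ≤-pred (subst (2 ≤_) (count-remove-true x fx) 2≤c)
... | y , y≢x∧fy with ∧-true⇒ {not ⌊ y ≟ x ⌋} y≢x∧fy
... | y≢x , fy = x , y , not-≟-true⇒≢ y≢x ∘ sym , fx , fy

two-witnesses⇒count : ∀ x y → x ≢ y → f x ≡ true → f y ≡ true → 2 ≤ count f
two-witnesses⇒count {f = f} x y x≢y fx fy rewrite count-remove-true {f = f} x fx =
  s≤s (witness⇒count y (cong₂ _∧_ (cong not (≢⇒≟-false (x≢y ∘ sym))) fy))

count-∨-≟ : (f : Fin m → Bool) (a : Fin m) → f a ≡ false →
  count (λ z → f z ∨ ⌊ z ≟ a ⌋) ≡ suc (count f)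
count-∨-≟ f a fa = begin
  count (λ z → f z ∨ ⌊ z ≟ a ⌋)
    ≡⟨ count-remove-true a (trans (cong (f a ∨_) (≟-refl a)) (∨-zeroʳ _)) ⟩
  suc (count (λ z → not ⌊ z ≟ a ⌋ ∧ (f z ∨ ⌊ z ≟ a ⌋)))
    ≡⟨ cong suc (count-cong elsewhere) ⟩
  suc (count f₋)
    ≡⟨ cong (λ b → suc (𝟙 b + count f₋)) fa ⟨
  suc (𝟙 (f a) + count f₋)
    ≡⟨ cong suc (count-remove f a) ⟨
  suc (count f) ∎
  where
  f₋ : Fin _ → Bool
  f₋ z = not ⌊ z ≟ a ⌋ ∧ f z
  elsewhere : ∀ z → not ⌊ z ≟ a ⌋ ∧ (f z ∨ ⌊ z ≟ a ⌋) ≡ f₋ z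
  elsewhere z with z ≟ a
  ... | yes _ = refl
  ... | no  _ = ∨-identityʳ (f z)

without : List (Fin m) → (Fin m → Bool) → Fin m → Bool
without []       f = f
without (a ∷ as) f = without as (λ z → not ⌊ z ≟ a ⌋ ∧ f z)

count-without : {as : List (Fin m)} → Unique as → (f : Fin m → Bool) →
  count f ≡ foldr (λ a s → 𝟙 (f a) + s) (count (without as f)) as
count-without []                  f = refl
count-without {as = a ∷ as} (a∉as ∷ u) f = begin
  count f
    ≡⟨ count-remove f a ⟩
  𝟙 (f a) + count f₋
    ≡⟨ cong (𝟙 (f a) +_) (count-without u f₋) ⟩
  𝟙 (f a) + foldr (λ b s → 𝟙 (f₋ b) + s) (count (without as f₋)) as
    ≡⟨ cong (𝟙 (f a) +_) (foldr-cong (All.map f₋≗f a∉as)) ⟩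
  𝟙 (f a) + foldr (λ b s → 𝟙 (f b) + s) (count (without as f₋)) as ∎
  where
  f₋ : Fin _ → Bool
  f₋ z = not ⌊ z ≟ a ⌋ ∧ f z
  f₋≗f : ∀ {b} → a ≢ b → f₋ b ≡ f b
  f₋≗f a≢b = cong (λ t → not t ∧ f _) (≢⇒≟-false (a≢b ∘ sym))
  foldr-cong : ∀ {bs s} → All (λ b → f₋ b ≡ f b) bs →
    foldr (λ b t → 𝟙 (f₋ b) + t) s bs ≡ foldr (λ b t → 𝟙 (f b) + t) s bs
  foldr-cong []         = refl
  foldr-cong (e ∷ es) = cong₂ _+_ (cong 𝟙 e) (foldr-cong es)

without-⊆ : (as : List (Fin m)) → ∀ {f z} → without as f z ≡ true → f z ≡ true
without-⊆ []       fz = fz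
without-⊆ (a ∷ as) fz = proj₂ (∧-true⇒ (without-⊆ as fz))

count-without-≤ : (as : List (Fin m)) → count (without as f) ≤ count f
count-without-≤ {f = f} as = count-mono {f = without as f} (λ z → without-⊆ as)

≡0⇒≤ : ∀ {x y} → x ≡ 0 → x ≤ y
≡0⇒≤ refl = z≤n

private
  variable
    h h₀ : Fin m → ℕ

sumFin-cong : (∀ i → h i ≡ h₀ i) → sumFin h ≡ sumFin h₀
sumFin-cong {zero}  h≗h₀ = refl
sumFin-cong {suc m} h≗h₀ = cong₂ _+_ (h≗h₀ zero) (sumFin-cong (h≗h₀ ∘ suc))

sumFin-mono : (∀ i → h i ≤ h₀ i) → sumFin h ≤ sumFin h₀
sumFin-mono {zero}  h≤h₀ = z≤n
sumFin-mono {suc m} h≤h₀ = +-mono-≤ (h≤h₀ zero) (sumFin-mono (h≤h₀ ∘ suc))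

sumFin-zero : (∀ i → h i ≡ 0) → sumFin h ≡ 0
sumFin-zero {zero}  h≗0 = refl
sumFin-zero {suc m} h≗0 = cong₂ _+_ (h≗0 zero) (sumFin-zero (h≗0 ∘ suc))

sumFin-concentrated : (c : Fin m) → (∀ i → i ≢ c → h i ≡ 0) → sumFin h ≡ h c
sumFin-concentrated {suc m} {h} zero h≗0 =
  trans (cong (h zero +_) (sumFin-zero (λ i → h≗0 (suc i) λ ()))) (+-identityʳ _)
sumFin-concentrated {suc m} (suc c) h≗0 =
  cong₂ _+_ (h≗0 zero λ ()) (sumFin-concentrated c (λ i i≢c → h≗0 (suc i) (i≢c ∘ suc-injective)))

sumFin-⊓≤-change-at : ∀ {k} {f f₀ g g₀ : Fin m → ℕ} (c : Fin m) →
  (∀ i → i ≢ c → f i ≤ f₀ i) → f c ≤ k → (∀ i → g i ≤ g₀ i) →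
  (1 ≤ g₀ c → ∀ i → f₀ i ⊓ g₀ i ≡ 0) →
  sumFin (λ i → f₀ i ⊓ g₀ i) ≤ k → sumFin (λ i → f i ⊓ g i) ≤ k
sumFin-⊓≤-change-at {k = k} {f} {f₀} {g} {g₀} c f≤f₀ fc≤k g≤g₀ disjoint old≤k with 1 ≤? g₀ c
... | yes 1≤g₀c =
  ≤-trans (≤-reflexive (sumFin-concentrated c vanishes)) (≤-trans (m⊓n≤m (f c) (g c)) fc≤k)
  where
  vanishes : ∀ i → i ≢ c → f i ⊓ g i ≡ 0
  vanishes i i≢c =
    n≤0⇒n≡0 (≤-trans (⊓-mono-≤ (f≤f₀ i i≢c) (g≤g₀ i)) (≤-reflexive (disjoint 1≤g₀c i)))
... | no ¬1≤g₀c = ≤-trans (sumFin-mono pointwise) old≤k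
  where
  pointwise : ∀ i → f i ⊓ g i ≤ f₀ i ⊓ g₀ i
  pointwise i with i ≟ c
  ... | no i≢c  = ⊓-mono-≤ (f≤f₀ i i≢c) (g≤g₀ i)
  ... | yes refl = ≡0⇒≤ (trans (cong (f c ⊓_) gc≡0) (⊓-zeroʳ (f c)))
    where
    gc≡0 : g c ≡ 0
    gc≡0 = n≤0⇒n≡0 (subst (g c ≤_) (n<1⇒n≡0 (≰⇒> ¬1≤g₀c)) (g≤g₀ c))

module Labelling {M n p : ℕ} (cell : Fin M → Fin n) (P : Fin M → Fin p) where

  private
    variable
      u w : Fin p
      i : Fin n
      z : Fin M

  ∈-part-cell : P z ≡ u → cell z ≡ i → (⌊ P z ≟ u ⌋ ∧ ⌊ cell z ≟ i ⌋) ≡ true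
  ∈-part-cell pz cz = cong₂ _∧_ (≡⇒≟-true pz) (≡⇒≟-true cz)

  1≤mult : P z ≡ u → cell z ≡ i → 1 ≤ mult cell P u i
  1≤mult {z} {u} {i} pz cz =
    witness⇒count {f = λ x → ⌊ P x ≟ u ⌋ ∧ ⌊ cell x ≟ i ⌋} z (∈-part-cell pz cz)

  hasLoop⇒2≤mult : HasLoop cell P u → ∃ λ i → 2 ≤ mult cell P u i
  hasLoop⇒2≤mult (x , y , x≢y , px , py , cx≡cy) =
    cell x , two-witnesses⇒count x y x≢y (∈-part-cell px refl) (∈-part-cell py (sym cx≡cy))

  2≤mult⇒hasLoop : 2 ≤ mult cell P u i → HasLoop cell P u
  2≤mult⇒hasLoop 2≤m with count⇒two-witnesses 2≤m
  ... | x , y , x≢y , x∈ , y∈ with ∧-true⇒ x∈ | ∧-true⇒ y∈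
  ... | px , cx | py , cy =
    x , y , x≢y , ≟-true⇒≡ px , ≟-true⇒≡ py , trans (≟-true⇒≡ cx) (sym (≟-true⇒≡ cy))

  ¬hasLoop⇒mult≤1 : ¬ HasLoop cell P u → ∀ i → mult cell P u i ≤ 1
  ¬hasLoop⇒mult≤1 ¬loop i with mult cell P _ i ≤? 1
  ... | yes m≤1 = m≤1
  ... | no  m≰1 = ⊥-elim (¬loop (2≤mult⇒hasLoop (≰⇒> m≰1)))

  ¬intersect⇒mult≡0 : ¬ Intersect cell P u w → 1 ≤ mult cell P w i → mult cell P u i ≡ 0
  ¬intersect⇒mult≡0 {u} {w} {i} ¬I 1≤w with mult cell P u i in e
  ... | zero  = refl
  ... | suc _ = ⊥-elim (¬I (i , subst (1 ≤_) (sym e) (s≤s z≤n) , 1≤w))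

  ¬intersect⇒⊓≡0 : ¬ Intersect cell P u w → ∀ i → mult cell P u i ⊓ mult cell P w i ≡ 0
  ¬intersect⇒⊓≡0 {u} {w} ¬I i with mult cell P w i in e
  ... | zero  = ⊓-zeroʳ _
  ... | suc _ = cong (_⊓ suc _) (¬intersect⇒mult≡0 ¬I (subst (1 ≤_) (sym e) (s≤s z≤n)))

  intersect-comm : Intersect cell P u w → Intersect cell P w u
  intersect-comm (i , 1≤u , 1≤w) = i , 1≤w , 1≤u

  interSize-comm : ∀ u w → interSize cell P u w ≡ interSize cell P w u
  interSize-comm u w = sumFin-cong λ i → ⊓-comm (mult cell P u i) _

  interSize-comm-≤ : ∀ {u w k} → interSize cell P w u ≤ k → interSize cell P u w ≤ k
  interSize-comm-≤ {u} {w} {k} = subst (_≤ k) (interSize-comm w u)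

  hasLoop? : ∀ u → Dec (HasLoop cell P u)
  hasLoop? u with any? (λ i → 2 ≤? mult cell P u i)
  ... | yes (i , 2≤m) = yes (2≤mult⇒hasLoop 2≤m)
  ... | no  ¬2≤m      = no (¬2≤m ∘ hasLoop⇒2≤mult)

  intersect? : ∀ u w → Dec (Intersect cell P u w)
  intersect? u w = any? λ i → (1 ≤? mult cell P u i) ×-dec (1 ≤? mult cell P w i)

data Side : Set where
  first second : Side

other : Side → Side
other first  = second
other second = first

module Switching {M n p : ℕ} (cell : Fin M → Fin n) (part : Fin M → Fin p) {x₁ x₂ y₁ y₂ : Fin M}
  (y₁≢y₂ : y₁ ≢ y₂) (y₂∈U : part y₁ ≡ part y₂)
  (U≢W₁ : part y₁ ≢ part x₁) (U≢W₂ : part y₁ ≢ part x₂) (W₁≢W₂ : part x₁ ≢ part x₂)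
  (x₁x₂-cell : cell x₁ ≡ cell x₂) (y₁y₂-cell : cell y₁ ≢ cell y₂) where

  part′ : Fin M → Fin p
  part′ = switch part x₁ x₂ y₁ y₂

  -- u and w j label both the old parts Û, Ŵⱼ and the new parts U, Wⱼ.

  x y : Side → Fin M
  x first  = x₁
  x second = x₂
  y first  = y₁
  y second = y₂

  u : Fin p
  u = part y₁

  w : Side → Fin p
  w j = part (x j)

  a : Fin n
  a = cell x₁

  b : Side → Fin n
  b j = cell (y j)

  y∈U : ∀ j → part (y j) ≡ u
  y∈U first  = refl
  y∈U second = sym y₂∈U

  U≢W : ∀ j → u ≢ w j
  U≢W first  = U≢W₁
  U≢W second = U≢W₂

  W≢W : ∀ j → w j ≢ w (other j)
  W≢W first  = W₁≢W₂
  W≢W second = ≢-sym W₁≢W₂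

  b≢b : ∀ j → b j ≢ b (other j)
  b≢b first  = y₁y₂-cell
  b≢b second = ≢-sym y₁y₂-cell

  y≢x : ∀ j k → y j ≢ x k
  y≢x j k yj≡xk = U≢W k (trans (sym (y∈U j)) (cong part yj≡xk))

  switched : List (Fin M)
  switched = x₁ ∷ x₂ ∷ y₁ ∷ y₂ ∷ []

  switched-unique : Unique switched
  switched-unique =
    (W₁≢W₂ ∘ cong part ∷ x≢y first first ∷ x≢y first second ∷ []) ∷
    (x≢y second first ∷ x≢y second second ∷ []) ∷
    (y₁≢y₂ ∷ []) ∷ [] ∷ []
    where
    x≢y : ∀ j k → x j ≢ y k
    x≢y j k = ≢-sym (y≢x k j)

  part′-x : ∀ j → part′ (x j) ≡ u
  part′-x first  rewrite ≟-refl x₁ = refl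
  part′-x second rewrite ≢⇒≟-false (W₁≢W₂ ∘ cong part ∘ sym) | ≟-refl x₂ = refl

  part′-y : ∀ j → part′ (y j) ≡ w j
  part′-y first
    rewrite ≢⇒≟-false (y≢x first first) | ≢⇒≟-false (y≢x first second) | ≟-refl y₁ = refl
  part′-y second
    rewrite ≢⇒≟-false (y≢x second first) | ≢⇒≟-false (y≢x second second)
          | ≢⇒≟-false (≢-sym y₁≢y₂) | ≟-refl y₂ = refl

  part′-elsewhere : (c : Fin p → Fin M → Bool) → ∀ z →
    without switched (λ z → c (part′ z) z) z ≡ without switched (λ z → c (part z) z) z
  part′-elsewhere c z with z ≟ x₁ | z ≟ x₂ | z ≟ y₁ | z ≟ y₂
  ... | no _ | no _ | no _ | no _ = refl
  ... | yes _ | _ | _ | _ = refl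
  ... | no _ | yes _ | _ | _ = refl
  ... | no _ | no _ | yes _ | _ = refl
  ... | no _ | no _ | no _ | yes _ = refl

  rest : (Fin p → Fin M → Bool) → ℕ
  rest c = count (without switched (λ z → c (part z) z))

  count-old : (c : Fin p → Fin M → Bool) → count (λ z → c (part z) z) ≡
    𝟙 (c (w first) x₁) + (𝟙 (c (w second) x₂) + (𝟙 (c u y₁) + (𝟙 (c u y₂) + rest c)))
  count-old c rewrite count-without switched-unique (λ z → c (part z) z) | y₂∈U = refl

  count-new : (c : Fin p → Fin M → Bool) → count (λ z → c (part′ z) z) ≡
    𝟙 (c u x₁) + (𝟙 (c u x₂) + (𝟙 (c (w first) y₁) + (𝟙 (c (w second) y₂) + rest c)))
  count-new c = trans (count-without switched-unique _)
    (cong₂ _+_ (at x₁ (part′-x first)) (cong₂ _+_ (at x₂ (part′-x second))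
      (cong₂ _+_ (at y₁ (part′-y first)) (cong₂ _+_ (at y₂ (part′-y second))
        (count-cong (part′-elsewhere c))))))
    where
    at : ∀ z {v} → part′ z ≡ v → 𝟙 (c (part′ z) z) ≡ 𝟙 (c v z)
    at z e = cong (λ v → 𝟙 (c v z)) e

  size-new≡size-old : ∀ v → size cell part′ v ≡ size cell part v
  size-new≡size-old v = begin
    size cell part′ v
      ≡⟨ count-new in-v ⟩
    δ u + (δ u + (δ (w first) + (δ (w second) + rest in-v)))
      ≡⟨ rearrange (δ u) (δ (w first)) (δ (w second)) (rest in-v) ⟩
    δ (w first) + (δ (w second) + (δ u + (δ u + rest in-v)))
      ≡⟨ count-old in-v ⟨
    size cell part v ∎
    where
    in-v : Fin p → Fin M → Bool
    in-v v′ _ = ⌊ v′ ≟ v ⌋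
    δ : Fin p → ℕ
    δ v′ = 𝟙 ⌊ v′ ≟ v ⌋
    rearrange : ∀ k l m r → k + (k + (l + (m + r))) ≡ l + (m + (k + (k + r)))
    rearrange = solve-∀

  in-cell : Fin p → Fin n → Fin p → Fin M → Bool
  in-cell v i v′ z = ⌊ v′ ≟ v ⌋ ∧ ⌊ cell z ≟ i ⌋

  mult-old mult-new mult-rest : Fin p → Fin n → ℕ
  mult-old = mult cell part
  mult-new = mult cell part′
  mult-rest v i = rest (in-cell v i)

  mult-rest≤mult-old : ∀ v i → mult-rest v i ≤ mult-old v i
  mult-rest≤mult-old v i = count-without-≤ switched

  mult-new-U : ∀ i → mult-new u i ≡ 𝟙 ⌊ a ≟ i ⌋ + (𝟙 ⌊ a ≟ i ⌋ + mult-rest u i)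
  mult-new-U i rewrite count-new (in-cell u i) | ≟-refl u | sym x₁x₂-cell
    | ≢⇒≟-false (≢-sym (U≢W first)) | ≢⇒≟-false (≢-sym (U≢W second)) = refl

  mult-new-W : ∀ j i → mult-new (w j) i ≡ 𝟙 ⌊ b j ≟ i ⌋ + mult-rest (w j) i
  mult-new-W j i rewrite count-new (in-cell (w j) i) | ≢⇒≟-false (U≢W j) = lemma j
    where
    lemma : ∀ j → 𝟙 (in-cell (w j) i (w first) y₁) + (𝟙 (in-cell (w j) i (w second) y₂) + mult-rest (w j) i)
                  ≡ 𝟙 ⌊ b j ≟ i ⌋ + mult-rest (w j) i
    lemma first  rewrite ≟-refl (w first)  | ≢⇒≟-false (W≢W second) = refl
    lemma second rewrite ≟-refl (w second) | ≢⇒≟-false (W≢W first) = refl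

  mult-old-U : ∀ i → mult-old u i ≡ 𝟙 ⌊ b first ≟ i ⌋ + (𝟙 ⌊ b second ≟ i ⌋ + mult-rest u i)
  mult-old-U i rewrite count-old (in-cell u i)
    | ≟-refl u | ≢⇒≟-false (≢-sym (U≢W first)) | ≢⇒≟-false (≢-sym (U≢W second)) = refl

  mult-old-W : ∀ j i → mult-old (w j) i ≡ 𝟙 ⌊ a ≟ i ⌋ + mult-rest (w j) i
  mult-old-W j i rewrite count-old (in-cell (w j) i) | ≢⇒≟-false (U≢W j) | sym x₁x₂-cell = lemma j
    where
    lemma : ∀ j → 𝟙 (in-cell (w j) i (w first) x₁) + (𝟙 (in-cell (w j) i (w second) x₁) + mult-rest (w j) i)
                ≡ 𝟙 ⌊ a ≟ i ⌋ + mult-rest (w j) i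
    lemma first  rewrite ≟-refl (w first)  | ≢⇒≟-false (W≢W second) = refl
    lemma second rewrite ≟-refl (w second) | ≢⇒≟-false (W≢W first) = refl

  mult-unchanged : ∀ {v} → v ≢ u → (∀ j → v ≢ w j) → ∀ i → mult-new v i ≡ mult-old v i
  mult-unchanged {v} v≢u v≢w i
    rewrite count-new (in-cell v i) | count-old (in-cell v i) | ≢⇒≟-false (≢-sym v≢u)
    | ≢⇒≟-false (≢-sym (v≢w first)) | ≢⇒≟-false (≢-sym (v≢w second)) = refl

  mult-old-U-at-b : ∀ j → mult-old u (b j) ≡ suc (mult-rest u (b j))
  mult-old-U-at-b first  rewrite mult-old-U (b first)  | ≟-refl (b first)  | ≢⇒≟-false (b≢b second) = refl
  mult-old-U-at-b second rewrite mult-old-U (b second) | ≟-refl (b second) | ≢⇒≟-false (b≢b first) = refl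

  mult-old-W-at-a : ∀ j → mult-old (w j) a ≡ suc (mult-rest (w j) a)
  mult-old-W-at-a j rewrite mult-old-W j a | ≟-refl a = refl

  mult-new-U-off : ∀ {i} → i ≢ a → mult-new u i ≡ mult-rest u i
  mult-new-U-off {i} i≢a rewrite mult-new-U i | ≢⇒≟-false (≢-sym i≢a) = refl

  mult-new-W-off : ∀ j {i} → i ≢ b j → mult-new (w j) i ≡ mult-rest (w j) i
  mult-new-W-off j {i} i≢b rewrite mult-new-W j i | ≢⇒≟-false (≢-sym i≢b) = refl

  data Role : Fin p → Set where
    U-role    : Role u
    W-role    : ∀ j → Role (w j)
    unchanged : ∀ {v} → v ≢ u → (∀ j → v ≢ w j) → Role v

  role : ∀ v → Role v
  role v with v ≟ u | v ≟ w first | v ≟ w second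
  ... | yes refl | _        | _        = U-role
  ... | no _     | yes refl | _        = W-role first
  ... | no _     | no _     | yes refl = W-role second
  ... | no v≢u   | no v≢w₁  | no v≢w₂  = unchanged v≢u λ { first → v≢w₁ ; second → v≢w₂ }

  U-new-loop : HasLoop cell part′ u
  U-new-loop = x₁ , x₂ , W₁≢W₂ ∘ cong part , part′-x first , part′-x second , x₁x₂-cell

  module Old = Labelling cell part
  module New = Labelling cell part′

  hasLoop-new⇒old : ∀ {v} → v ≢ u → (∀ j → v ≢ w j) → HasLoop cell part′ v → HasLoop cell part v
  hasLoop-new⇒old v≢u v≢w loop with i , 2≤m ← New.hasLoop⇒2≤mult loop =
    Old.2≤mult⇒hasLoop (subst (2 ≤_) (mult-unchanged v≢u v≢w i) 2≤m)

  hasLoop-old⇒new : ∀ {v} → v ≢ u → (∀ j → v ≢ w j) → HasLoop cell part v → HasLoop cell part′ v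
  hasLoop-old⇒new v≢u v≢w loop with i , 2≤m ← Old.hasLoop⇒2≤mult loop =
    New.2≤mult⇒hasLoop (subst (2 ≤_) (sym (mult-unchanged v≢u v≢w i)) 2≤m)

  rest≤1 : ∀ {v} → ¬ HasLoop cell part v → ∀ i → mult-rest v i ≤ 1
  rest≤1 ¬loop i = ≤-trans (mult-rest≤mult-old _ i) (Old.¬hasLoop⇒mult≤1 ¬loop i)

  rest≡0-if-old≡0 : ∀ {v i} → mult-old v i ≡ 0 → mult-rest v i ≡ 0
  rest≡0-if-old≡0 {v} {i} old≡0 =
    n≤0⇒n≡0 (subst (mult-rest v i ≤_) old≡0 (mult-rest≤mult-old v i))

  rest≡0-if-sole : ∀ {v i} → ¬ HasLoop cell part v →
    mult-old v i ≡ suc (mult-rest v i) → mult-rest v i ≡ 0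
  rest≡0-if-sole {v} {i} ¬loop e = n≤0⇒n≡0 (≤-pred (subst (_≤ 1) e (Old.¬hasLoop⇒mult≤1 ¬loop i)))

  module Unobstructed
    (U-loopless : ¬ HasLoop cell part u)
    (W-loopless : ∀ j → ¬ HasLoop cell part (w j))
    (U∩W≡∅ : ∀ j → ¬ Intersect cell part u (w j))
    (no-common-neighbour : ∀ {v} → v ≢ u → (∀ j → v ≢ w j) →
       Intersect cell part v u → ∀ j → ¬ Intersect cell part v (w j))
    where

    U-old-at-a : mult-old u a ≡ 0
    U-old-at-a = Old.¬intersect⇒mult≡0 (U∩W≡∅ first) (Old.1≤mult refl refl)

    W-old-at-b : ∀ j k → mult-old (w j) (b k) ≡ 0
    W-old-at-b j k = Old.¬intersect⇒mult≡0 (U∩W≡∅ j ∘ Old.intersect-comm) (Old.1≤mult (y∈U k) refl)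

    a≢b : ∀ j → a ≢ b j
    a≢b j a≡b with () ← subst (1 ≤_) (W-old-at-b first j) (Old.1≤mult refl a≡b)

    U-new-at-a : mult-new u a ≡ 2
    U-new-at-a rewrite mult-new-U a | ≟-refl a | rest≡0-if-old≡0 U-old-at-a = refl

    W-new-at-b : ∀ j → mult-new (w j) (b j) ≡ 1
    W-new-at-b j rewrite mult-new-W j (b j) | ≟-refl (b j) | rest≡0-if-old≡0 (W-old-at-b j j) = refl

    U-new≤old-off : ∀ i → i ≢ a → mult-new u i ≤ mult-old u i
    U-new≤old-off i i≢a = subst (_≤ mult-old u i) (sym (mult-new-U-off i≢a)) (mult-rest≤mult-old u i)

    W-new≤old-off : ∀ j i → i ≢ b j → mult-new (w j) i ≤ mult-old (w j) i
    W-new≤old-off j i i≢b =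
      subst (_≤ mult-old (w j) i) (sym (mult-new-W-off j i≢b)) (mult-rest≤mult-old (w j) i)

    U-new-off≤1 : ∀ {i} → i ≢ a → mult-new u i ≤ 1
    U-new-off≤1 {i} i≢a = subst (_≤ 1) (sym (mult-new-U-off i≢a)) (rest≤1 U-loopless i)

    U-new≤2 : ∀ i → mult-new u i ≤ 2
    U-new≤2 i with i ≟ a
    ... | yes refl = ≤-reflexive U-new-at-a
    ... | no  i≢a  = ≤-trans (U-new-off≤1 i≢a) (s≤s z≤n)

    U-new≡2⇒a : ∀ {i} → mult-new u i ≡ 2 → i ≡ a
    U-new≡2⇒a {i} m≡2 with i ≟ a
    ... | yes i≡a = i≡a
    ... | no  i≢a with s≤s () ← subst (_≤ 1) m≡2 (U-new-off≤1 i≢a)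

    W-new≤1 : ∀ j i → mult-new (w j) i ≤ 1
    W-new≤1 j i with i ≟ b j
    ... | yes refl = ≤-reflexive (W-new-at-b j)
    ... | no  i≢b  = subst (_≤ 1) (sym (mult-new-W-off j i≢b)) (rest≤1 (W-loopless j) i)

    U∩W-new : ∀ j i → mult-new u i ⊓ mult-new (w j) i ≡ 0
    U∩W-new j i with i ≟ a
    ... | yes refl = trans (cong (mult-new u a ⊓_) W-new-at-a) (⊓-zeroʳ _)
      where
      W-new-at-a : mult-new (w j) a ≡ 0
      W-new-at-a = trans (mult-new-W-off j (a≢b j)) (rest≡0-if-sole (W-loopless j) (mult-old-W-at-a j))
    ... | no i≢a with i ≟ b j
    ...   | yes refl = cong (_⊓ mult-new (w j) (b j))
                             (trans (mult-new-U-off i≢a) (rest≡0-if-sole U-loopless (mult-old-U-at-b j)))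
    ...   | no  i≢b  = n≤0⇒n≡0 (≤-trans (⊓-mono-≤ (U-new≤old-off i i≢a) (W-new≤old-off j i i≢b))
                                         (≤-reflexive (Old.¬intersect⇒⊓≡0 (U∩W≡∅ j) i)))

    W∩W-new≤old : ∀ j i →
      mult-new (w j) i ⊓ mult-new (w (other j)) i ≤ mult-old (w j) i ⊓ mult-old (w (other j)) i
    W∩W-new≤old j i with i ≟ b j
    ... | yes refl = ≡0⇒≤ (trans (cong (mult-new (w j) (b j) ⊓_) other-at-b) (⊓-zeroʳ _))
      where
      other-at-b : mult-new (w (other j)) (b j) ≡ 0
      other-at-b = trans (mult-new-W-off (other j) (b≢b j)) (rest≡0-if-old≡0 (W-old-at-b (other j) j))
    ... | no i≢b with i ≟ b (other j)
    ...   | yes refl = ≡0⇒≤ (cong (_⊓ mult-new (w (other j)) (b (other j)))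
                                   (trans (mult-new-W-off j i≢b) (rest≡0-if-old≡0 (W-old-at-b j (other j)))))
    ...   | no  i≢b′ = ⊓-mono-≤ (W-new≤old-off j i i≢b) (W-new≤old-off (other j) i i≢b′)

    U-vs-W : ∀ j → interSize cell part′ u (w j) ≤ 2
    U-vs-W j = ≡0⇒≤ (sumFin-zero (U∩W-new j))

    U-vs-unchanged : ∀ {o} → o ≢ u → (∀ j → o ≢ w j) →
      interSize cell part u o ≤ 2 → interSize cell part′ u o ≤ 2
    U-vs-unchanged {o} o≢u o≢w =
      sumFin-⊓≤-change-at a U-new≤old-off (≤-reflexive U-new-at-a)
        (λ i → ≤-reflexive (mult-unchanged o≢u o≢w i)) disjoint
      where
      disjoint : 1 ≤ mult-old o a → ∀ i → mult-old u i ⊓ mult-old o i ≡ 0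
      disjoint o∋a = Old.¬intersect⇒⊓≡0 λ I →
        no-common-neighbour o≢u o≢w (Old.intersect-comm I) first (a , o∋a , Old.1≤mult refl refl)

    W-vs-unchanged : ∀ j {o} → o ≢ u → (∀ k → o ≢ w k) →
      interSize cell part (w j) o ≤ 2 → interSize cell part′ (w j) o ≤ 2
    W-vs-unchanged j {o} o≢u o≢w =
      sumFin-⊓≤-change-at (b j) (W-new≤old-off j) (≤-trans (≤-reflexive (W-new-at-b j)) (s≤s z≤n))
        (λ i → ≤-reflexive (mult-unchanged o≢u o≢w i)) disjoint
      where
      disjoint : 1 ≤ mult-old o (b j) → ∀ i → mult-old (w j) i ⊓ mult-old o i ≡ 0
      disjoint o∋b = Old.¬intersect⇒⊓≡0 λ I →
        no-common-neighbour o≢u o≢w (b j , o∋b , Old.1≤mult (y∈U j) refl) j (Old.intersect-comm I)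

    W-vs-W : ∀ j k → w j ≢ w k → (∀ v v′ → v ≢ v′ → interSize cell part v v′ ≤ 2) →
      interSize cell part′ (w j) (w k) ≤ 2
    W-vs-W first  first  ne _   = ⊥-elim (ne refl)
    W-vs-W second second ne _   = ⊥-elim (ne refl)
    W-vs-W first  second _  old = ≤-trans (sumFin-mono (W∩W-new≤old first))  (old _ _ (W≢W first))
    W-vs-W second first  _  old = ≤-trans (sumFin-mono (W∩W-new≤old second)) (old _ _ (W≢W second))

    switch-mult≤2 : (∀ v i → mult-old v i ≤ 2) → ∀ v i → mult-new v i ≤ 2
    switch-mult≤2 old v i with role v
    ... | U-role            = U-new≤2 i
    ... | W-role j          = ≤-trans (W-new≤1 j i) (s≤s z≤n)
    ... | unchanged v≢u v≢w = subst (_≤ 2) (sym (mult-unchanged v≢u v≢w i)) (old v i)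

    switch-mult≡2-unique : (∀ v i i′ → mult-old v i ≡ 2 → mult-old v i′ ≡ 2 → i ≡ i′) →
      ∀ v i i′ → mult-new v i ≡ 2 → mult-new v i′ ≡ 2 → i ≡ i′
    switch-mult≡2-unique old v i i′ m≡2 m′≡2 with role v
    ... | U-role            = trans (U-new≡2⇒a m≡2) (sym (U-new≡2⇒a m′≡2))
    ... | W-role j with s≤s () ← subst (_≤ 1) m≡2 (W-new≤1 j i)
    ... | unchanged v≢u v≢w =
      old v i i′ (trans (sym (mult-unchanged v≢u v≢w i)) m≡2) (trans (sym (mult-unchanged v≢u v≢w i′)) m′≡2)

    switch-interSize≤2 : (∀ v v′ → v ≢ v′ → interSize cell part v v′ ≤ 2) →
      ∀ v v′ → v ≢ v′ → interSize cell part′ v v′ ≤ 2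
    switch-interSize≤2 old v v′ v≢v′ with role v | role v′
    ... | U-role   | U-role   = ⊥-elim (v≢v′ refl)
    ... | U-role   | W-role j = U-vs-W j
    ... | U-role   | unchanged o≢u o≢w = U-vs-unchanged o≢u o≢w (old u v′ v≢v′)
    ... | W-role j | U-role   = New.interSize-comm-≤ (U-vs-W j)
    ... | W-role j | W-role k = W-vs-W j k v≢v′ old
    ... | W-role j | unchanged o≢u o≢w = W-vs-unchanged j o≢u o≢w (old (w j) v′ v≢v′)
    ... | unchanged o≢u o≢w | U-role   =
      New.interSize-comm-≤ (U-vs-unchanged o≢u o≢w (old u v (≢-sym v≢v′)))
    ... | unchanged o≢u o≢w | W-role j =
      New.interSize-comm-≤ (W-vs-unchanged j o≢u o≢w (old (w j) v (≢-sym v≢v′)))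
    ... | unchanged o≢u o≢w | unchanged o′≢u o′≢w =
      subst (_≤ 2) (sumFin-cong λ i → sym (cong₂ _⊓_ (mult-unchanged o≢u o≢w i) (mult-unchanged o′≢u o′≢w i)))
        (old v v′ v≢v′)

    W-new-loopless : ∀ j → ¬ HasLoop cell part′ (w j)
    W-new-loopless j loop with i , 2≤m ← New.hasLoop⇒2≤mult loop
      with s≤s () ← ≤-trans 2≤m (W-new≤1 j i)

    switch-LoopParts : ∀ {ℓ} → LoopParts cell part ℓ → LoopParts cell part′ (suc ℓ)
    switch-LoopParts (sel , sel-spec , count-sel) =
      sel′ , sel′-spec , trans (count-∨-≟ sel u (unselected U-loopless)) (cong suc count-sel)
      where
      unselected : ∀ {v} → ¬ HasLoop cell part v → sel v ≡ false
      unselected {v} ¬loop with sel v in e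
      ... | true  = ⊥-elim (¬loop (proj₁ (sel-spec v) e))
      ... | false = refl

      sel′ : Fin p → Bool
      sel′ v = sel v ∨ ⌊ v ≟ u ⌋

      sel′-spec : ∀ v → (sel′ v ≡ true → HasLoop cell part′ v) × (HasLoop cell part′ v → sel′ v ≡ true)
      sel′-spec v with role v
      ... | U-role = (λ _ → U-new-loop) , (λ _ → trans (cong (sel u ∨_) (≟-refl u)) (∨-zeroʳ _))
      ... | W-role j = (λ e → contradiction (trans (sym e) sel′-W) λ ()) , (⊥-elim ∘ W-new-loopless j)
        where
        sel′-W : sel′ (w j) ≡ false
        sel′-W = cong₂ _∨_ (unselected (W-loopless j)) (≢⇒≟-false (≢-sym (U≢W j)))
      ... | unchanged v≢u v≢w =
        (λ e → hasLoop-old⇒new v≢u v≢w (proj₁ (sel-spec v) (trans (sym sel′≡sel) e))) ,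
        (λ loop → trans sel′≡sel (proj₂ (sel-spec v) (hasLoop-new⇒old v≢u v≢w loop)))
        where
        sel′≡sel : sel′ v ≡ sel v
        sel′≡sel = trans (cong (sel v ∨_) (≢⇒≟-false v≢u)) (∨-identityʳ _)

    switch-InC : ∀ {r N ℓ} → InC cell part r N ℓ → suc ℓ ≤ N → InC cell part′ r N (suc ℓ)
    switch-InC (sizes , mult≤2 , mult≡2-unique , interSize≤2 , loops , _) sℓ≤N =
      (λ v → trans (size-new≡size-old v) (sizes v)) ,
      switch-mult≤2 mult≤2 ,
      switch-mult≡2-unique mult≡2-unique ,
      switch-interSize≤2 interSize≤2 ,
      switch-LoopParts loops ,
      sℓ≤N

  Obstruction : Set
  Obstruction =
    (HasLoop cell part u ⊎ HasLoop cell part (w first) ⊎ HasLoop cell part (w second))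
    ⊎ (Intersect cell part u (w first) ⊎ Intersect cell part u (w second))
    ⊎ (Σ (Fin p) λ v → v ≢ u × v ≢ w first × v ≢ w second
        × Intersect cell part v u
        × (Intersect cell part v (w first) ⊎ Intersect cell part v (w second)))

  obstruction? : Dec Obstruction
  obstruction? =
    (Old.hasLoop? u ⊎-dec Old.hasLoop? (w first) ⊎-dec Old.hasLoop? (w second))
    ⊎-dec (Old.intersect? u (w first) ⊎-dec Old.intersect? u (w second))
    ⊎-dec any? λ v → ¬? (v ≟ u) ×-dec ¬? (v ≟ w first) ×-dec ¬? (v ≟ w second)
                     ×-dec Old.intersect? v u
                     ×-dec (Old.intersect? v (w first) ⊎-dec Old.intersect? v (w second))

  unobstructed⇒InC : ¬ Obstruction →
    ∀ {r N ℓ} → InC cell part r N ℓ → suc ℓ ≤ N → InC cell part′ r N (suc ℓ)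
  unobstructed⇒InC ¬obs = Unobstructed.switch-InC
    (¬obs ∘ inj₁ ∘ inj₁)
    (λ { first → ¬obs ∘ inj₁ ∘ inj₂ ∘ inj₁ ; second → ¬obs ∘ inj₁ ∘ inj₂ ∘ inj₂ })
    (λ { first → ¬obs ∘ inj₂ ∘ inj₁ ∘ inj₁ ; second → ¬obs ∘ inj₂ ∘ inj₁ ∘ inj₂ })
    (λ { v≢u v≢w I first J → ¬obs (inj₂ (inj₂ (_ , v≢u , v≢w first , v≢w second , I , inj₁ J)))
       ; v≢u v≢w I second J → ¬obs (inj₂ (inj₂ (_ , v≢u , v≢w first , v≢w second , I , inj₂ J))) })

  illegal⇒obstruction : ∀ {r N ℓ} → InC cell part r N ℓ → suc ℓ ≤ N →
    ¬ InC cell part′ r N (suc ℓ) → Obstruction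
  illegal⇒obstruction old sℓ≤N illegal with obstruction?
  ... | yes obs  = obs
  ... | no  ¬obs = ⊥-elim (illegal (unobstructed⇒InC ¬obs old sℓ≤N))

lemma2p2 : (n M p r N ℓ : ℕ) → (cell : Fin M → Fin n) → (part : Fin M → Fin p) →
    3 ≤ r → 1 ≤ ℓ → ℓ ≤ N →
    InC cell part r N (ℓ ∸ 1) →
    (x₁ x₂ y₁ y₂ : Fin M) →
    IsReverseSwitching cell part x₁ x₂ y₁ y₂ →
    ¬ InC cell (switch part x₁ x₂ y₁ y₂) r N ℓ →
    (HasLoop cell part (part y₁) ⊎ HasLoop cell part (part x₁) ⊎ HasLoop cell part (part x₂))
    ⊎ (Intersect cell part (part y₁) (part x₁) ⊎ Intersect cell part (part y₁) (part x₂))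
    ⊎ (Σ (Fin p) λ w → w ≢ part y₁ × w ≢ part x₁ × w ≢ part x₂
        × Intersect cell part w (part y₁)
        × (Intersect cell part w (part x₁) ⊎ Intersect cell part w (part x₂)))
lemma2p2 n M p r N zero cell part _ () _ _ _ _ _ _ _ _
lemma2p2 n M p r N (suc ℓ) cell part _ _ sℓ≤N old x₁ x₂ y₁ y₂
  (y₁≢y₂ , y₂∈U , U≢W₁ , U≢W₂ , W₁≢W₂ , x-cells , y-cells) =
  Switching.illegal⇒obstruction cell part y₁≢y₂ y₂∈U U≢W₁ U≢W₂ W₁≢W₂ x-cells y-cells old sℓ≤N
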